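{- Let $(T,\eta,(-)^\dagger)$ be a monad on $\mathbf{Cont}$ and $\mathsf{c}:\langle\!\langle-\rangle\!\rangle\to\langle\!\langle T(-)\rangle\!\rangle$ a right $T$-comodule structure map. Then the categories $\mathbf{Cont}_T^{\mathrm{op}}$ and $\mathbf{RFun}(T,\langle\!\langle-\rangle\!\rangle,\mathsf{c})$ have finite products, and the functor $\mathcal{F}:\mathbf{Cont}_T^{\mathrm{op}}\to\mathbf{RFun}(T,\langle\!\langle-\rangle\!\rangle,\mathsf{c})$, which is the identity on objects and sends a Kleisli morphism $f\triangleleft g:B\triangleleft Q\to T(A\triangleleft P)$ to $\langle\!\langle f\triangleleft g\rangle\!\rangle\circ\mathsf{c}_{A\triangleleft P}:\langle\!\langle A\triangleleft P\rangle\!\rangle\to\langle\!\langle B\triangleleft Q\rangle\!\rangle$, preserves finite products.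
   Context: Work in extensional Martin-Löf type theory. $\mathbf{Cont}$ is the category of containers $A\triangleleft P$ ($A$ a type, $P:A\to\mathbf{Type}$) with morphisms $f\triangleleft g:A\triangleleft P\to B\triangleleft Q$ given by $f:A\to B$ and $g:\prod_{\{a:A\}}(Q\,(f\,a)\to P\,a)$, composed componentwise (positions in reverse). $\langle\!\langle-\rangle\!\rangle:\mathbf{Cont}^{\mathrm{op}}\to\mathbf{Type}$ is $\langle\!\langle A\triangleleft P\rangle\!\rangle=\prod_{a:A}P\,a$, $\langle\!\langle f\triangleleft g\rangle\!\rangle\,\alpha=\lambda a.\,g\{a\}(\alpha(f\,a))$. A right $T$-comodule structure map is a natural $\mathsf{c}:\langle\!\langle-\rangle\!\rangle\to\langle\!\langle T(-)\rangle\!\rangle$ with $\langle\!\langle\eta_X\rangle\!\rangle\circ\mathsf{c}_X=\mathrm{id}$ and $\mathsf{c}_{TX}\circ\mathsf{c}_X=\langle\!\langle\mu_X\rangle\!\rangle\circ\mathsf{c}_X$ ($\mu_X=(\mathrm{id}_{TX})^\dagger$). $\mathbf{Cont}_T$ is the Kleisli category of $T$: same objects, morphisms $X\to_T Y$ are container morphisms $X\to TY$, identities $\eta_X$, composition $g\circ_T f=g^\dagger\circ f$. $\mathbf{RFun}(T,\langle\!\langle-\rangle\!\rangle,\mathsf{c})$ is the category whose objects are containers and whose morphisms $A\triangleleft P\to B\triangleleft Q$ are those maps $F:\langle\!\langle A\triangleleft P\rangle\!\rangle\to\langle\!\langle B\triangleleft Q\rangle\!\rangle$ for which there exists a container morphism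 $\tau\triangleleft e:B\triangleleft Q\to T(A\triangleleft P)$ with $F=\langle\!\langle\tau\triangleleft e\rangle\!\rangle\circ\mathsf{c}_{A\triangleleft P}$, with ordinary function composition. -}

module Defs where

open import Level using (Level; _⊔_) renaming (suc to lsuc)
open import Data.Product using (Σ; _×_; _,_; proj₁; proj₂)
open import Relation.Binary.PropositionalEquality using (_≡_; refl; sym; trans; cong)

record Cont : Set₁ where
  constructor _◁_
  field
    Sh  : Set
    Pos : Sh → Set
open Cont public

record ContHom (X Y : Cont) : Set where
  constructor _◁ₘ_
  field
    shf : Sh X → Sh Y
    posf : ∀ {a : Sh X} → Pos Y (shf a) → Pos X a
open ContHom public

idC : (X : Cont) → ContHom X X
idC X = (λ a → a) ◁ₘ (λ p → p)

_∘C_ : ∀ {X Y Z} → ContHom Y Z → ContHom X Y → ContHom X Z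
(f ◁ₘ g) ∘C (f' ◁ₘ g') = (λ a → f (f' a)) ◁ₘ (λ {a} q → g' {a} (g {f' a} q))

⟪_⟫ : Cont → Set
⟪ A ◁ P ⟫ = (a : A) → P a

⟪_⟫₁ : ∀ {X Y} → ContHom X Y → ⟪ Y ⟫ → ⟪ X ⟫
⟪ f ◁ₘ g ⟫₁ α = λ a → g {a} (α (f a))

record KleisliTriple : Set₁ where
  field
    T   : Cont → Cont
    η   : (X : Cont) → ContHom X (T X)
    _†  : ∀ {X Y} → ContHom X (T Y) → ContHom (T X) (T Y)
    †-η  : ∀ {X Y} (f : ContHom X (T Y)) → ((f †) ∘C η X) ≡ f
    η-†  : ∀ X → (η X †) ≡ idC (T X)
    †-∘  : ∀ {X Y Z} (f : ContHom X (T Y)) (g : ContHom Y (T Z)) →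
           (((g †) ∘C f) †) ≡ ((g †) ∘C (f †))

  T₁ : ∀ {X Y} → ContHom X Y → ContHom (T X) (T Y)
  T₁ {X} {Y} h = (η Y ∘C h) †

  μ : (X : Cont) → ContHom (T (T X)) (T X)
  μ X = idC (T X) †

  _∘T_ : ∀ {X Y Z} → ContHom Y (T Z) → ContHom X (T Y) → ContHom X (T Z)
  g ∘T f = (g †) ∘C f

record Comodule (M : KleisliTriple) : Set₁ where
  open KleisliTriple M
  field
    c : (X : Cont) → ⟪ X ⟫ → ⟪ T X ⟫
    natural : ∀ {X Y} (h : ContHom X Y) (α : ⟪ Y ⟫) →
              c X (⟪ h ⟫₁ α) ≡ ⟪ T₁ h ⟫₁ (c Y α)
    counit  : ∀ X (α : ⟪ X ⟫) → ⟪ η X ⟫₁ (c X α) ≡ α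
    coassoc : ∀ X (α : ⟪ X ⟫) → c (T X) (c X α) ≡ ⟪ μ X ⟫₁ (c X α)

record CatData (o h e : Level) : Set (lsuc (o ⊔ h ⊔ e)) where
  field
    Obj : Set o
    Hom : Obj → Obj → Set h
    _≈_ : ∀ {X Y} → Hom X Y → Hom X Y → Set e
    id  : ∀ X → Hom X X
    _∘_ : ∀ {X Y Z} → Hom Y Z → Hom X Y → Hom X Z

module _ {o h e} (C : CatData o h e) where
  open CatData C

  IsTerminal : Obj → Set (o ⊔ h ⊔ e)
  IsTerminal t = ∀ X → Σ (Hom X t) λ u → ∀ (v : Hom X t) → v ≈ u

  IsProduct : ∀ {X Y} (P : Obj) → Hom P X → Hom P Y → Set (o ⊔ h ⊔ e)
  IsProduct {X} {Y} P p₁ p₂ =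
    ∀ Z (f : Hom Z X) (g : Hom Z Y) →
      Σ (Hom Z P) λ u → ((p₁ ∘ u) ≈ f) × ((p₂ ∘ u) ≈ g) ×
        (∀ (v : Hom Z P) → (p₁ ∘ v) ≈ f → (p₂ ∘ v) ≈ g → v ≈ u)

  HasFiniteProducts : Set (o ⊔ h ⊔ e)
  HasFiniteProducts =
    Σ Obj IsTerminal ×
    (∀ X Y → Σ Obj λ P → Σ (Hom P X) λ p₁ → Σ (Hom P Y) λ p₂ → IsProduct P p₁ p₂)

module _ (M : KleisliTriple) (Cm : Comodule M) where
  open KleisliTriple M
  open Comodule Cm

  KleisliOp : CatData (Level.suc Level.zero) Level.zero Level.zero
  KleisliOp = record
    { Obj = Cont
    ; Hom = λ X Y → ContHom Y (T X)
    ; _≈_ = _≡_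
    ; id  = η
    ; _∘_ = λ g f → f ∘T g
    }

  RHom : Cont → Cont → Set
  RHom X Y = Σ (⟪ X ⟫ → ⟪ Y ⟫) λ F →
             Σ (ContHom Y (T X)) λ k → ∀ α → F α ≡ ⟪ k ⟫₁ (c X α)

  RFun-id : ∀ X → RHom X X
  RFun-id X = (λ α → α) , η X , λ α → sym (counit X α)

  RFun-∘ : ∀ {X Y Z} → RHom Y Z → RHom X Y → RHom X Z
  RFun-∘ {X} {Y} {Z} (G , l , Gp) (F , k , Fp) =
    (λ α → G (F α)) , (μ X ∘C (T₁ k ∘C l)) , λ α →
      trans (Gp (F α))
      (trans (cong (λ β → ⟪ l ⟫₁ (c Y β)) (Fp α))
      (trans (cong ⟪ l ⟫₁ (natural k (c X α)))
             (cong (λ β → ⟪ l ⟫₁ (⟪ T₁ k ⟫₁ β)) (coassoc X α))))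

  RFun : CatData (Level.suc Level.zero) Level.zero Level.zero
  RFun = record
    { Obj = Cont
    ; Hom = RHom
    ; _≈_ = λ F G → ∀ α → proj₁ F α ≡ proj₁ G α
    ; id  = RFun-id
    ; _∘_ = RFun-∘
    }

  𝓕₁ : ∀ {X Y} → ContHom Y (T X) → RHom X Y
  𝓕₁ {X} k = (λ α → ⟪ k ⟫₁ (c X α)) , k , λ α → refl

  PreservesFiniteProducts : Set₁
  PreservesFiniteProducts =
    (∀ (t : Cont) → IsTerminal KleisliOp t → IsTerminal RFun t) ×
    (∀ {X Y} (P : Cont) (p₁ : ContHom X (T P)) (p₂ : ContHom Y (T P)) →
       IsProduct KleisliOp P p₁ p₂ → IsProduct RFun P (𝓕₁ p₁) (𝓕₁ p₂))

module Submission where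

open import Defs
open import Level using (Level; 0ℓ)
open import Data.Empty using (⊥)
open import Data.Product using (Σ; _×_; _,_; proj₁; proj₂)
open import Data.Sum using (_⊎_; inj₁; inj₂)
open import Axiom.Extensionality.Propositional using (Extensionality)
open import Relation.Binary.PropositionalEquality
  using (_≡_; refl; sym; trans; cong; cong-app; module ≡-Reasoning)

-- Products in Cont_T^op are coproducts of containers, X ⊕ Y = (Sh X ⊎ Sh Y) ◁ [Pos X, Pos Y],
-- with the empty container as terminal object.  The functor F(k) = ⟪ k ⟫ ∘ c is functorial
-- because the comodule laws give  c ∘ ⟪ u ⟫ ∘ c = ⟪ u † ⟫ ∘ c.  Since every RFun-morphism is
-- F of some Kleisli map, existence of mediators in RFun comes from Cont_T^op.  For uniqueness,
-- any product (P, p₁, p₂) in Cont_T^op is isomorphic to X ⊕ Y, so ⟪ P ⟫ is a retract of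
-- ⟪ X ⊕ Y ⟫ ≅ ⟪ X ⟫ × ⟪ Y ⟫ via β ↦ (F p₁ β , F p₂ β); this pairing is therefore injective.

pointwise : ∀ {X Y} → ContHom X Y → (a : Sh X) → Σ (Sh Y) λ b → Pos Y b → Pos X a
pointwise h a = shf h a , posf h {a}

⊥C : Cont
⊥C = ⊥ ◁ λ ()

¡ : ∀ {X} → ContHom ⊥C X
¡ = (λ ()) ◁ₘ λ { {()} }

_⊕_ : Cont → Cont → Cont
X ⊕ Y = (Sh X ⊎ Sh Y) ◁ λ { (inj₁ a) → Pos X a ; (inj₂ b) → Pos Y b }

inlC : ∀ X Y → ContHom X (X ⊕ Y)
inlC X Y = inj₁ ◁ₘ λ p → p

inrC : ∀ X Y → ContHom Y (X ⊕ Y)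
inrC X Y = inj₂ ◁ₘ λ p → p

copair : ∀ {X Y W} → ContHom X W → ContHom Y W → ContHom (X ⊕ Y) W
copair {X} {Y} {W} f g = shape ◁ₘ λ {s} → position {s}
  where
  shape : Sh (X ⊕ Y) → Sh W
  shape (inj₁ a) = shf f a
  shape (inj₂ b) = shf g b

  position : ∀ {s} → Pos W (shape s) → Pos (X ⊕ Y) s
  position {inj₁ a} = posf f
  position {inj₂ b} = posf g

module _ (funext : Extensionality 0ℓ 0ℓ) where

  ContHom-ext : ∀ {X Y} {h h' : ContHom X Y} → (∀ a → pointwise h a ≡ pointwise h' a) → h ≡ h'
  ContHom-ext e = cong fromPointwise (funext e)
    where
    fromPointwise : ∀ {X Y} → ((a : Sh X) → Σ (Sh Y) λ b → Pos Y b → Pos X a) → ContHom X Y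
    fromPointwise φ = (λ a → proj₁ (φ a)) ◁ₘ λ {a} → proj₂ (φ a)

  ¡-unique : ∀ {X} (v : ContHom ⊥C X) → v ≡ ¡
  ¡-unique v = ContHom-ext λ ()

  copair-unique : ∀ {X Y W} {f : ContHom X W} {g : ContHom Y W} (v : ContHom (X ⊕ Y) W) →
                  (v ∘C inlC X Y) ≡ f → (v ∘C inrC X Y) ≡ g → v ≡ copair f g
  copair-unique v refl refl = ContHom-ext λ
    { (inj₁ a) → refl
    ; (inj₂ b) → refl
    }

module Kleisli (M : KleisliTriple) where
  open KleisliTriple M

  ∘T-pure : ∀ {X Y Z} (h : ContHom Y (T Z)) (k : ContHom X Y) → (h ∘T (η Y ∘C k)) ≡ (h ∘C k)
  ∘T-pure h k = cong (_∘C k) (†-η h)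

  η-∘T : ∀ {X Y} (f : ContHom X (T Y)) → (η Y ∘T f) ≡ f
  η-∘T {Y = Y} f = cong (_∘C f) (η-† Y)

  ∘T-assoc : ∀ {W X Y Z} (h : ContHom Y (T Z)) (g : ContHom X (T Y)) (f : ContHom W (T X)) →
             ((h ∘T g) ∘T f) ≡ (h ∘T (g ∘T f))
  ∘T-assoc h g f = cong (_∘C f) (†-∘ g h)

  μ∘T₁≡† : ∀ {X Y} (u : ContHom Y (T X)) → (μ X ∘C T₁ u) ≡ (u †)
  μ∘T₁≡† {X} u = trans (sym (†-∘ (η (T X) ∘C u) (idC (T X)))) (cong (λ h → (h ∘C u) †) (†-η (idC (T X))))

  ι₁ : ∀ X Y → ContHom X (T (X ⊕ Y))
  ι₁ X Y = η (X ⊕ Y) ∘C inlC X Y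

  ι₂ : ∀ X Y → ContHom Y (T (X ⊕ Y))
  ι₂ X Y = η (X ⊕ Y) ∘C inrC X Y

module Functor (M : KleisliTriple) (Cm : Comodule M) where
  open KleisliTriple M
  open Comodule Cm
  open Kleisli M

  𝓕 : ∀ {X Y} → ContHom Y (T X) → ⟪ X ⟫ → ⟪ Y ⟫
  𝓕 {X} k α = ⟪ k ⟫₁ (c X α)

  c-𝓕 : ∀ {X Y} (u : ContHom Y (T X)) (α : ⟪ X ⟫) → c Y (𝓕 u α) ≡ ⟪ u † ⟫₁ (c X α)
  c-𝓕 {X} u α = begin
    c _ (⟪ u ⟫₁ (c X α))                   ≡⟨ natural u (c X α) ⟩
    ⟪ T₁ u ⟫₁ (c (T X) (c X α))            ≡⟨ cong ⟪ T₁ u ⟫₁ (coassoc X α) ⟩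
    ⟪ μ X ∘C T₁ u ⟫₁ (c X α)               ≡⟨ cong (λ h → ⟪ h ⟫₁ (c X α)) (μ∘T₁≡† u) ⟩
    ⟪ u † ⟫₁ (c X α)                       ∎
    where open ≡-Reasoning

  𝓕-∘T : ∀ {X Y Z} (g : ContHom Y (T X)) (f : ContHom Z (T Y)) (α : ⟪ X ⟫) →
         𝓕 f (𝓕 g α) ≡ 𝓕 (g ∘T f) α
  𝓕-∘T g f α = cong ⟪ f ⟫₁ (c-𝓕 g α)

  𝓕-cong : ∀ {X Y} {k k' : ContHom Y (T X)} → k ≡ k' → ∀ α → 𝓕 k α ≡ 𝓕 k' α
  𝓕-cong e α = cong (λ k → 𝓕 k α) e

module _ (funext : Extensionality 0ℓ 0ℓ) (M : KleisliTriple) (Cm : Comodule M) where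
  open KleisliTriple M
  open Comodule Cm
  open Kleisli M
  open Functor M Cm

  ⊥C-isTerminal : IsTerminal (KleisliOp M Cm) ⊥C
  ⊥C-isTerminal X = ¡ , ¡-unique funext

  ⊕-isProduct : ∀ X Y → IsProduct (KleisliOp M Cm) (X ⊕ Y) (ι₁ X Y) (ι₂ X Y)
  ⊕-isProduct X Y Z f g =
    copair f g , ∘T-pure (copair f g) (inlC X Y) , ∘T-pure (copair f g) (inrC X Y) ,
    λ v v₁ v₂ → copair-unique funext v
      (trans (sym (∘T-pure v (inlC X Y))) v₁) (trans (sym (∘T-pure v (inrC X Y))) v₂)

  kleisliOp-hasFiniteProducts : HasFiniteProducts (KleisliOp M Cm)
  kleisliOp-hasFiniteProducts =
    (⊥C , ⊥C-isTerminal) , λ X Y → X ⊕ Y , ι₁ X Y , ι₂ X Y , ⊕-isProduct X Y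

  product-jointly-monic : ∀ {X Y P Z} {p₁ : ContHom X (T P)} {p₂ : ContHom Y (T P)} →
                          IsProduct (KleisliOp M Cm) P p₁ p₂ → (v w : ContHom P (T Z)) →
                          (v ∘T p₁) ≡ (w ∘T p₁) → (v ∘T p₂) ≡ (w ∘T p₂) → v ≡ w
  product-jointly-monic {P = P} {Z} {p₁} {p₂} isP v w e₁ e₂ =
    trans (unique v e₁ e₂) (sym (unique w refl refl))
    where
    unique : ∀ (u : ContHom P (T Z)) → (u ∘T p₁) ≡ (w ∘T p₁) → (u ∘T p₂) ≡ (w ∘T p₂) →
             u ≡ proj₁ (isP Z (w ∘T p₁) (w ∘T p₂))
    unique = proj₂ (proj₂ (proj₂ (isP Z (w ∘T p₁) (w ∘T p₂))))

  𝓕-jointly-injective : ∀ {X Y P} {p₁ : ContHom X (T P)} {p₂ : ContHom Y (T P)} →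
                        IsProduct (KleisliOp M Cm) P p₁ p₂ → ∀ {β β' : ⟪ P ⟫} →
                        𝓕 p₁ β ≡ 𝓕 p₁ β' → 𝓕 p₂ β ≡ 𝓕 p₂ β' → β ≡ β'
  𝓕-jointly-injective {X} {Y} {P} {p₁} {p₂} isP {β} {β'} e₁ e₂ = begin
    β                ≡⟨ sym (retraction β) ⟩
    𝓕 i (𝓕 j β)     ≡⟨ cong (𝓕 i) (funext λ { (inj₁ x) → cong-app e₁ x ; (inj₂ y) → cong-app e₂ y }) ⟩
    𝓕 i (𝓕 j β')    ≡⟨ retraction β' ⟩
    β'               ∎
    where
    open ≡-Reasoning
    j : ContHom (X ⊕ Y) (T P)
    j = copair p₁ p₂
    i : ContHom P (T (X ⊕ Y))
    i = proj₁ (isP (X ⊕ Y) (ι₁ X Y) (ι₂ X Y))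
    i-p₁ : (i ∘T p₁) ≡ ι₁ X Y
    i-p₁ = proj₁ (proj₂ (isP (X ⊕ Y) (ι₁ X Y) (ι₂ X Y)))
    i-p₂ : (i ∘T p₂) ≡ ι₂ X Y
    i-p₂ = proj₁ (proj₂ (proj₂ (isP (X ⊕ Y) (ι₁ X Y) (ι₂ X Y))))

    j∘Ti-on : ∀ {V} (p : ContHom V (T P)) (ι : ContHom V (X ⊕ Y)) →
              (i ∘T p) ≡ (η (X ⊕ Y) ∘C ι) → (j ∘C ι) ≡ p → ((j ∘T i) ∘T p) ≡ (η P ∘T p)
    j∘Ti-on p ι i∘Tp j∘ι = begin
      (j ∘T i) ∘T p           ≡⟨ ∘T-assoc j i p ⟩
      j ∘T (i ∘T p)           ≡⟨ cong (j ∘T_) i∘Tp ⟩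
      j ∘T (η (X ⊕ Y) ∘C ι)   ≡⟨ ∘T-pure j ι ⟩
      j ∘C ι                  ≡⟨ j∘ι ⟩
      p                       ≡⟨ sym (η-∘T p) ⟩
      η P ∘T p                ∎

    j∘Ti≡η : (j ∘T i) ≡ η P
    j∘Ti≡η = product-jointly-monic {p₁ = p₁} {p₂} isP (j ∘T i) (η P)
      (j∘Ti-on p₁ (inlC X Y) i-p₁ refl)
      (j∘Ti-on p₂ (inrC X Y) i-p₂ refl)

    retraction : ∀ β → 𝓕 i (𝓕 j β) ≡ β
    retraction β = trans (𝓕-∘T j i β) (trans (𝓕-cong j∘Ti≡η β) (counit P β))

  𝓕-preserves-terminal : ∀ t → IsTerminal (KleisliOp M Cm) t → IsTerminal (RFun M Cm) t
  𝓕-preserves-terminal t term X =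
    𝓕₁ M Cm (proj₁ (term X)) , λ { (V , k , V≡) α → trans (V≡ α) (𝓕-cong (proj₂ (term X) k) α) }

  𝓕-preserves-product : ∀ {X Y} P (p₁ : ContHom X (T P)) (p₂ : ContHom Y (T P)) →
                        IsProduct (KleisliOp M Cm) P p₁ p₂ → IsProduct (RFun M Cm) P (𝓕₁ M Cm p₁) (𝓕₁ M Cm p₂)
  𝓕-preserves-product P p₁ p₂ isP Z (F , k , F≡) (G , l , G≡) =
    𝓕₁ M Cm u , u-p₁ , u-p₂ , λ { (V , _ , _) V-p₁ V-p₂ α →
      𝓕-jointly-injective {p₁ = p₁} {p₂} isP (trans (V-p₁ α) (sym (u-p₁ α))) (trans (V-p₂ α) (sym (u-p₂ α))) }
    where
    u : ContHom P (T Z)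
    u = proj₁ (isP Z k l)

    u-p₁ : ∀ α → 𝓕 p₁ (𝓕 u α) ≡ F α
    u-p₁ α = trans (𝓕-∘T u p₁ α) (trans (𝓕-cong (proj₁ (proj₂ (isP Z k l))) α) (sym (F≡ α)))

    u-p₂ : ∀ α → 𝓕 p₂ (𝓕 u α) ≡ G α
    u-p₂ α = trans (𝓕-∘T u p₂ α) (trans (𝓕-cong (proj₁ (proj₂ (proj₂ (isP Z k l)))) α) (sym (G≡ α)))

  𝓕-preservesFiniteProducts : PreservesFiniteProducts M Cm
  𝓕-preservesFiniteProducts = 𝓕-preserves-terminal , 𝓕-preserves-product

  rFun-hasFiniteProducts : HasFiniteProducts (RFun M Cm)
  rFun-hasFiniteProducts =
    (⊥C , 𝓕-preserves-terminal ⊥C ⊥C-isTerminal) ,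
    λ X Y → X ⊕ Y , 𝓕₁ M Cm (ι₁ X Y) , 𝓕₁ M Cm (ι₂ X Y) ,
            𝓕-preserves-product (X ⊕ Y) (ι₁ X Y) (ι₂ X Y) (⊕-isProduct X Y)

proposition7 : (funext : ∀ {a b : Level} → Extensionality a b) →
               (M : KleisliTriple) (Cm : Comodule M) →
               HasFiniteProducts (KleisliOp M Cm) × HasFiniteProducts (RFun M Cm) ×
               PreservesFiniteProducts M Cm
proposition7 funext M Cm =
  kleisliOp-hasFiniteProducts funext M Cm ,
  rFun-hasFiniteProducts funext M Cm ,
  𝓕-preservesFiniteProducts funext M Cm
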